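{- There exists a Butson Hadamard matrix $BH(18,14)$.
   Context: A Butson Hadamard matrix $BH(n,q)$ is an $n\times n$ complex matrix all of whose entries are $q$th roots of unity and whose rows are pairwise orthogonal with respect to the standard complex inner product on $\mathbb{C}^n$. -}

module Defs where

open import Data.Nat using (ℕ; zero; suc; _∸_) renaming (_+_ to _+ℕ_)
open import Data.Fin using (Fin; toℕ; zero; suc)
open import Data.Integer using (ℤ; +_; _+_; _-_; -_)
open import Data.Vec using (Vec; []; _∷_)
open import Data.Product using (Σ)
open import Relation.Binary.PropositionalEquality using (_≡_)
open import Relation.Nullary using (¬_)

-- Exact arithmetic in the cyclotomic ring ℤ[ω] ⊂ ℂ, where
-- ω = exp(2πi/14) is a primitive 14th root of unity.
-- ℤ[ω] ≅ ℤ[x]/(Φ₁₄(x)), Φ₁₄(x) = x⁶ - x⁵ + x⁴ - x³ + x² - x + 1,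
-- with ℤ-basis 1, ω, …, ω⁵.  An element is its coordinate vector
-- (a₀, …, a₅) meaning a₀ + a₁ω + … + a₅ω⁵; equality of elements
-- (as complex numbers) is equality of coordinate vectors.
Cyc14 : Set
Cyc14 = Vec ℤ 6

zeroC : Cyc14
zeroC = + 0 ∷ + 0 ∷ + 0 ∷ + 0 ∷ + 0 ∷ + 0 ∷ []

oneC : Cyc14
oneC = + 1 ∷ + 0 ∷ + 0 ∷ + 0 ∷ + 0 ∷ + 0 ∷ []

_+C_ : Cyc14 → Cyc14 → Cyc14
(a0 ∷ a1 ∷ a2 ∷ a3 ∷ a4 ∷ a5 ∷ []) +C (b0 ∷ b1 ∷ b2 ∷ b3 ∷ b4 ∷ b5 ∷ []) =
  (a0 + b0) ∷ (a1 + b1) ∷ (a2 + b2) ∷ (a3 + b3) ∷ (a4 + b4) ∷ (a5 + b5) ∷ []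

-- multiplication by ω, using ω⁶ = ω⁵ - ω⁴ + ω³ - ω² + ω - 1
mulω : Cyc14 → Cyc14
mulω (a0 ∷ a1 ∷ a2 ∷ a3 ∷ a4 ∷ a5 ∷ []) =
  (- a5) ∷ (a0 + a5) ∷ (a1 - a5) ∷ (a2 + a5) ∷ (a3 - a5) ∷ (a4 + a5) ∷ []

ωpow : ℕ → Cyc14
ωpow zero = oneC
ωpow (suc n) = mulω (ωpow n)

sumC : (n : ℕ) → (Fin n → Cyc14) → Cyc14
sumC zero f = zeroC
sumC (suc n) f = f zero +C sumC n (λ k → f (suc k))

-- Every 14th root of unity is ω^e for a unique e ∈ {0,…,13}; an n×n
-- matrix with 14th-root-of-unity entries is given by its exponent matrix.
ExpMatrix14 : ℕ → Set
ExpMatrix14 n = Fin n → Fin n → Fin 14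

-- Standard complex inner product of rows i and j:
--   Σ_k ω^{H i k} · conj(ω^{H j k}) = Σ_k ω^{H i k + (14 - H j k)}
rowInner : {n : ℕ} → ExpMatrix14 n → Fin n → Fin n → Cyc14
rowInner {n} H i j = sumC n (λ k → ωpow (toℕ (H i k) +ℕ (14 ∸ toℕ (H j k))))

IsBH14 : {n : ℕ} → ExpMatrix14 n → Set
IsBH14 {n} H = (i j : Fin n) → ¬ (i ≡ j) → rowInner H i j ≡ zeroC

{-# OPTIONS --safe #-}
module Submission where

open import Defs
open import Data.Product using (Σ; _,_)
open import Data.Nat using (ℕ)
open import Data.Fin using (Fin; #_)
open import Data.Fin.Properties using (all?) renaming (_≟_ to _≟F_)
open import Data.Vec using (Vec; []; _∷_; lookup)
open import Data.Vec.Properties using (≡-dec)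
open import Data.Integer using () renaming (_≟_ to _≟ℤ_)
open import Relation.Nullary using (¬?; Dec)
open import Relation.Binary.PropositionalEquality using (_≡_)
open import Relation.Nullary.Decidable using (toWitness; _→-dec_)

_≟C_ : (x y : Cyc14) → Dec (x ≡ y)
_≟C_ = ≡-dec _≟ℤ_

isBH14? : {n : ℕ} (H : ExpMatrix14 n) → Dec (IsBH14 H)
isBH14? H = all? λ i → all? λ j → ¬? (i ≟F j) →-dec (rowInner H i j ≟C zeroC)

fromRows : {n : ℕ} → Vec (Vec (Fin 14) n) n → ExpMatrix14 n
fromRows rows i j = lookup (lookup rows i) j

-- The upper-left 14 × 14 part consists of four circulant 7 × 7 blocks.
bh-18-14 : ExpMatrix14 18
bh-18-14 = fromRows (
  (# 0 ∷ # 0 ∷ # 8 ∷ # 12 ∷ # 9 ∷ # 12 ∷ # 8 ∷ # 0 ∷ # 0 ∷ # 8 ∷ # 12 ∷ # 2 ∷ # 12 ∷ # 8 ∷ # 12 ∷ # 13 ∷ # 3 ∷ # 1 ∷ []) ∷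
  (# 8 ∷ # 0 ∷ # 0 ∷ # 8 ∷ # 12 ∷ # 9 ∷ # 12 ∷ # 8 ∷ # 0 ∷ # 0 ∷ # 8 ∷ # 12 ∷ # 2 ∷ # 12 ∷ # 10 ∷ # 11 ∷ # 5 ∷ # 3 ∷ []) ∷
  (# 12 ∷ # 8 ∷ # 0 ∷ # 0 ∷ # 8 ∷ # 12 ∷ # 9 ∷ # 12 ∷ # 8 ∷ # 0 ∷ # 0 ∷ # 8 ∷ # 12 ∷ # 2 ∷ # 8 ∷ # 9 ∷ # 7 ∷ # 5 ∷ []) ∷
  (# 9 ∷ # 12 ∷ # 8 ∷ # 0 ∷ # 0 ∷ # 8 ∷ # 12 ∷ # 2 ∷ # 12 ∷ # 8 ∷ # 0 ∷ # 0 ∷ # 8 ∷ # 12 ∷ # 6 ∷ # 7 ∷ # 9 ∷ # 7 ∷ []) ∷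
  (# 12 ∷ # 9 ∷ # 12 ∷ # 8 ∷ # 0 ∷ # 0 ∷ # 8 ∷ # 12 ∷ # 2 ∷ # 12 ∷ # 8 ∷ # 0 ∷ # 0 ∷ # 8 ∷ # 4 ∷ # 5 ∷ # 11 ∷ # 9 ∷ []) ∷
  (# 8 ∷ # 12 ∷ # 9 ∷ # 12 ∷ # 8 ∷ # 0 ∷ # 0 ∷ # 8 ∷ # 12 ∷ # 2 ∷ # 12 ∷ # 8 ∷ # 0 ∷ # 0 ∷ # 2 ∷ # 3 ∷ # 13 ∷ # 11 ∷ []) ∷
  (# 0 ∷ # 8 ∷ # 12 ∷ # 9 ∷ # 12 ∷ # 8 ∷ # 0 ∷ # 0 ∷ # 8 ∷ # 12 ∷ # 2 ∷ # 12 ∷ # 8 ∷ # 0 ∷ # 0 ∷ # 1 ∷ # 1 ∷ # 13 ∷ []) ∷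
  (# 12 ∷ # 6 ∷ # 6 ∷ # 12 ∷ # 8 ∷ # 4 ∷ # 8 ∷ # 5 ∷ # 13 ∷ # 13 ∷ # 5 ∷ # 1 ∷ # 4 ∷ # 1 ∷ # 8 ∷ # 2 ∷ # 11 ∷ # 2 ∷ []) ∷
  (# 8 ∷ # 12 ∷ # 6 ∷ # 6 ∷ # 12 ∷ # 8 ∷ # 4 ∷ # 1 ∷ # 5 ∷ # 13 ∷ # 13 ∷ # 5 ∷ # 1 ∷ # 4 ∷ # 6 ∷ # 0 ∷ # 13 ∷ # 4 ∷ []) ∷
  (# 4 ∷ # 8 ∷ # 12 ∷ # 6 ∷ # 6 ∷ # 12 ∷ # 8 ∷ # 4 ∷ # 1 ∷ # 5 ∷ # 13 ∷ # 13 ∷ # 5 ∷ # 1 ∷ # 4 ∷ # 12 ∷ # 1 ∷ # 6 ∷ []) ∷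
  (# 8 ∷ # 4 ∷ # 8 ∷ # 12 ∷ # 6 ∷ # 6 ∷ # 12 ∷ # 1 ∷ # 4 ∷ # 1 ∷ # 5 ∷ # 13 ∷ # 13 ∷ # 5 ∷ # 2 ∷ # 10 ∷ # 3 ∷ # 8 ∷ []) ∷
  (# 12 ∷ # 8 ∷ # 4 ∷ # 8 ∷ # 12 ∷ # 6 ∷ # 6 ∷ # 5 ∷ # 1 ∷ # 4 ∷ # 1 ∷ # 5 ∷ # 13 ∷ # 13 ∷ # 0 ∷ # 8 ∷ # 5 ∷ # 10 ∷ []) ∷
  (# 6 ∷ # 12 ∷ # 8 ∷ # 4 ∷ # 8 ∷ # 12 ∷ # 6 ∷ # 13 ∷ # 5 ∷ # 1 ∷ # 4 ∷ # 1 ∷ # 5 ∷ # 13 ∷ # 12 ∷ # 6 ∷ # 7 ∷ # 12 ∷ []) ∷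
  (# 6 ∷ # 6 ∷ # 12 ∷ # 8 ∷ # 4 ∷ # 8 ∷ # 12 ∷ # 13 ∷ # 13 ∷ # 5 ∷ # 1 ∷ # 4 ∷ # 1 ∷ # 5 ∷ # 10 ∷ # 4 ∷ # 9 ∷ # 0 ∷ []) ∷
  (# 11 ∷ # 13 ∷ # 1 ∷ # 3 ∷ # 5 ∷ # 7 ∷ # 9 ∷ # 7 ∷ # 5 ∷ # 3 ∷ # 1 ∷ # 13 ∷ # 11 ∷ # 9 ∷ # 1 ∷ # 2 ∷ # 11 ∷ # 2 ∷ []) ∷
  (# 13 ∷ # 1 ∷ # 3 ∷ # 5 ∷ # 7 ∷ # 9 ∷ # 11 ∷ # 2 ∷ # 0 ∷ # 12 ∷ # 10 ∷ # 8 ∷ # 6 ∷ # 4 ∷ # 3 ∷ # 4 ∷ # 6 ∷ # 11 ∷ []) ∷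
  (# 10 ∷ # 8 ∷ # 6 ∷ # 4 ∷ # 2 ∷ # 0 ∷ # 12 ∷ # 7 ∷ # 9 ∷ # 11 ∷ # 13 ∷ # 1 ∷ # 3 ∷ # 5 ∷ # 0 ∷ # 8 ∷ # 3 ∷ # 1 ∷ []) ∷
  (# 4 ∷ # 2 ∷ # 0 ∷ # 12 ∷ # 10 ∷ # 8 ∷ # 6 ∷ # 8 ∷ # 10 ∷ # 12 ∷ # 0 ∷ # 2 ∷ # 4 ∷ # 6 ∷ # 1 ∷ # 9 ∷ # 11 ∷ # 9 ∷ []) ∷
  [])

mainTheorem4 : Σ (ExpMatrix14 18) IsBH14
mainTheorem4 = bh-18-14 , toWitness {a? = isBH14? bh-18-14} _
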